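{- For every $n\ge 1$ we have $\sigma\circ\kappa=\kappa\circ\rho$ as maps $\mathcal{NC}_n\to\mathcal{C}_n$. Here Dyck paths of size $n$ are identified with chord diagrams in $\mathcal{C}_n$ as described below.
   Context: $\mathcal{NC}_n$ is the set of non-crossing partitions of $[n]$ (no $i<j<k<l$ with $i,k$ in one block and $j,l$ in another block). $\rho$ is the Kreweras endomorphism: place points on a circle in clockwise order $1',1,2',2,\dots,n',n$ ($i'$ between $i-1$ and $i$, and $1'$ between $n$ and $1$). Then $i,j$ lie in the same block of $\rho(\pi)$ if and only if $i',j'$ lie in the same region of the disk cut by the polygons of the blocks of $\pi$. $\kappa$: order the blocks $B_1,\dots,B_m$ of $\pi$ with $\min B_1<\dots<\min B_m$ and let $D(B):=U(UR)^{|B|-1}R$. Put $P_1=D(B_1)$, and obtain $P_{i+1}$ from $P_i$ by inserting $D(B_{i+1})$ immediately after the $2(\min B_{i+1}-1)$-th letter. Set $\kappa(\pi)=P_m$, a Dyck word of length $2n$. $\mathcal{C}_n$ is the set of non-crossing perfect matchings of the positions $1,\dots,2n$ on a line. A Dyck word is identified with the matching that pairs each $U$ with its corresponding $R$ under the usual parenthesis matching. $\sigma$ is the rotation on $\mathcal{C}_n$: with $\phi(p)=p+1$ for $p<2n$ and $\phi(2n)=1$, set $\sigma(C)=\{\{\phi(a),\phi(b)\}:\{a,b\}\in C\}$. -}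

module Defs where

open import Data.Nat using (ℕ; zero; suc; _+_; _*_; _∸_; _<ᵇ_)
open import Data.Bool using (Bool; true; false; T; not; _∧_; _∨_; if_then_else_)
open import Data.Fin using (Fin; toℕ; _<_; _≤_)
open import Data.List using (List; []; _∷_; _++_; map; foldl; filter; length; allFin; take; drop)

allB : {A : Set} → (A → Bool) → List A → Bool
allB p [] = true
allB p (x ∷ xs) = p x ∧ allB p xs
open import Data.Product using (_×_; _,_)
open import Data.Sum using (_⊎_)
open import Data.List.Membership.Propositional using (_∈_)
open import Relation.Nullary.Decidable using (does)
open import Data.Fin using (_<?_; _≤?_)

-- Set partitions of [n] (elements 1..n are represented by Fin n, with
-- element i represented by the Fin whose toℕ is i-1), given by their
-- decidable "same block" relation.

BlockRel : ℕ → Set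
BlockRel n = Fin n → Fin n → Bool

record IsSetPartition {n : ℕ} (π : BlockRel n) : Set where
  field
    reflexive  : ∀ i → T (π i i)
    symmetric  : ∀ i j → T (π i j) → T (π j i)
    transitive : ∀ i j k → T (π i j) → T (π j k) → T (π i k)

-- no i<j<k<l with i,k in one block and j,l in another (different) block
NonCrossing : {n : ℕ} → BlockRel n → Set
NonCrossing {n} π = ∀ (i j k l : Fin n) → i < j → j < k → k < l →
  T (π i k) → T (π j l) → T (π i j)

IsNC : {n : ℕ} → BlockRel n → Set
IsNC π = IsSetPartition π × NonCrossing π

-- For i ≤ j, the points i' and j' lie in the same region cut out by the
-- block polygons of π iff no block of π meets both the arc
-- {i, ..., j-1} (the unprimed points between i' and j') and its
-- complement.

inArc : {n : ℕ} → Fin n → Fin n → Fin n → Bool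
inArc a b k = does (a ≤? k) ∧ does (k <? b)

sameRegion : {n : ℕ} → BlockRel n → Fin n → Fin n → Bool
sameRegion {n} π a b =
  allB (λ k → allB (λ l → not (inArc a b k ∧ not (inArc a b l) ∧ π k l))
                 (allFin n))
      (allFin n)

ρ : {n : ℕ} → BlockRel n → BlockRel n
ρ π i j = if does (i ≤? j) then sameRegion π i j else sameRegion π j i

Word : Set
Word = List Bool

U R : Bool
U = true
R = false

UR^ : ℕ → Word
UR^ zero = []
UR^ (suc k) = U ∷ R ∷ UR^ k

D : ℕ → Word
D size = U ∷ (UR^ (size ∸ 1) ++ (R ∷ []))

insertAfter : ℕ → Word → Word → Word
insertAfter p v w = take p w ++ v ++ drop p w

isBlockMin : {n : ℕ} → BlockRel n → Fin n → Bool
isBlockMin {n} π m = allB (λ j → not (does (j <? m) ∧ π m j)) (allFin n)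

blockSize : {n : ℕ} → BlockRel n → Fin n → ℕ
blockSize {n} π m = length (filter (λ j → T? (π m j)) (allFin n))
  where
  open import Relation.Nullary using (Dec; yes; no)
  T? : (b : Bool) → Dec (T b)
  T? true = yes _
  T? false = no (λ ())

blockMins : {n : ℕ} → BlockRel n → List (Fin n)
blockMins {n} π = filter (λ m → T? (isBlockMin π m)) (allFin n)
  where
  open import Relation.Nullary using (Dec; yes; no)
  T? : (b : Bool) → Dec (T b)
  T? true = yes _
  T? false = no (λ ())

-- κ: insert D(B_{i}) after the 2(min B_i - 1)-th letter, in order of minima.
-- (toℕ m = min B - 1.)
κ : {n : ℕ} → BlockRel n → Word
κ π = foldl (λ P m → insertAfter (2 * toℕ m) (D (blockSize π m)) P) [] (blockMins π)

-- Non-crossing perfect matchings of positions 1..2n, as lists of pairs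
-- {a,b} (a set of unordered pairs).

Matching : Set
Matching = List (ℕ × ℕ)

-- usual parenthesis matching: pairs each U with its corresponding R
-- (positions are 1-based)
matchGo : Word → ℕ → List ℕ → Matching
matchGo [] p s = []
matchGo (true ∷ w) p s = matchGo w (suc p) (p ∷ s)
matchGo (false ∷ w) p [] = matchGo w (suc p) []
matchGo (false ∷ w) p (q ∷ s) = (q , p) ∷ matchGo w (suc p) s

toMatching : Word → Matching
toMatching w = matchGo w 1 []

Paired : Matching → ℕ → ℕ → Set
Paired C x y = ((x , y) ∈ C) ⊎ ((y , x) ∈ C)

φ : ℕ → ℕ → ℕ
φ n p = if p <ᵇ 2 * n then suc p else 1

σ : ℕ → Matching → Matching
σ n C = map (λ { (a , b) → (φ n a , φ n b) }) C

{-# OPTIONS --safe #-}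
-- Element i of [n] contributes two letters to κ(π): U or R according as i is or is not the
-- minimum of its block, then U or R according as i is not or is the maximum of its block;
-- inserting the words D(B) block by block, in order of minima, puts exactly these letters in place.
-- For the Kreweras complement, i + 1 is a block minimum of ρ(π) iff i is not a block maximum of π,
-- and i is a block maximum of ρ(π) iff i is not a block minimum of π, except for the minimum b of
-- the block containing n, which is a block maximum of ρ(π). So if κ(π) = A U B R with that U
-- contributed by b, then κ(ρ(π)) = U A R B. Here A and B are Dyck words, the U and the final R
-- form a chord, and rotating the chord diagram of A U B R by one position turns that chord into
-- (1, |A| + 2) and shifts every other chord by one: this is the chord diagram of U A R B.
module Submission where

open import Defs
open import Data.Nat using (ℕ; zero; suc; _+_; _*_; _∸_; _≤_; _<_; _<ᵇ_; _≤ᵇ_; z≤n; s≤s; z<s)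
open import Data.Nat.Properties
open import Data.Nat.Induction using (<-rec)
open import Data.Nat.Solver using (module +-*-Solver)
open import Data.Bool using (Bool; true; false; T; not; _∧_; _∨_; if_then_else_)
open import Data.Bool.Properties using (T-≡; T-∧; T-∨; ∨-identityʳ; not-involutive)
open import Data.Empty using (⊥-elim)
open import Data.Unit using (tt)
open import Data.Fin as Fin using (Fin; toℕ; fromℕ<)
open import Data.Fin.Properties using (toℕ<n; toℕ-fromℕ<; fromℕ<-toℕ)
open import Data.List using (List; []; _∷_; _++_; map; filter; foldl; length; take; tabulate; allFin)
open import Data.List.Properties
  using (take++drop≡id; map-++; length-++; length-map; ++-assoc; ++-identityʳ; filter-++; filter-all; filter-none;
         filter-accept; filter-reject; foldl-++; foldl-map; foldl-cong; map-tabulate)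
open import Data.List.Membership.Propositional using (_∈_)
open import Data.List.Membership.Propositional.Properties using (∈-filter⁻; ∈-allFin)
open import Data.List.Relation.Unary.All as All using (All; []; _∷_)
open import Data.List.Relation.Unary.Any using (here; there)
open import Data.List.Relation.Unary.Any.Properties using (¬Any[])
open import Data.List.Relation.Binary.Permutation.Propositional using (_↭_; ↭-sym)
open import Data.List.Relation.Binary.Permutation.Propositional.Properties using (∈-resp-↭; shift; ++-comm)
open import Data.Product using (_×_; _,_; ∃-syntax; proj₁; proj₂; swap)
open import Data.Sum as Sum using (inj₁; inj₂; [_,_]′)
open import Function using (_∘_; id)
open import Function.Bundles using (_⇔_; mk⇔; Equivalence)
open import Relation.Nullary using (¬_; Dec; yes; no; does)
open import Relation.Nullary.Decidable using (T?)
open import Relation.Binary.Definitions using (tri<; tri≈; tri>)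
open import Relation.Binary.PropositionalEquality
open Equivalence using (to; from)

¬T⇒≡false : ∀ {b} → ¬ T b → b ≡ false
¬T⇒≡false {false} _ = refl
¬T⇒≡false {true} ¬t = ⊥-elim (¬t tt)

T-not : ∀ {b} → T (not b) ⇔ (¬ T b)
T-not {false} = mk⇔ (λ _ ()) (λ _ → tt)
T-not {true} = mk⇔ (λ ()) (λ ¬t → ¬t tt)

T-does : ∀ {A : Set} (d : Dec A) → T (does d) ⇔ A
T-does (yes a) = mk⇔ (λ _ → a) (λ _ → tt)
T-does (no ¬a) = mk⇔ (λ ()) (λ a → ¬a a)

T-injective : ∀ {a b} → (T a ⇔ T b) → a ≡ b
T-injective {false} {false} _ = refl
T-injective {false} {true} a⇔b = ⊥-elim (from a⇔b tt)
T-injective {true} {false} a⇔b = ⊥-elim (to a⇔b tt)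
T-injective {true} {true} _ = refl

≡not-intro : ∀ {a b} → (T a → ¬ T b) → (¬ T a → T b) → b ≡ not a
≡not-intro {false} {true} _ _ = refl
≡not-intro {false} {false} _ ¬a⇒b = ⊥-elim (¬a⇒b (λ ()))
≡not-intro {true} {false} _ _ = refl
≡not-intro {true} {true} a⇒¬b _ = ⊥-elim (a⇒¬b tt tt)

T-allB : ∀ {A : Set} (f : A → Bool) xs → T (allB f xs) ⇔ (∀ {x} → x ∈ xs → T (f x))
T-allB f [] = mk⇔ (λ _ ()) (λ _ → tt)
T-allB f (x ∷ xs) with f x in fx
... | true = mk⇔ (λ t → λ { (here refl) → subst T (sym fx) tt ; (there x∈) → to (T-allB f xs) t x∈ })
                 (λ h → from (T-allB f xs) (λ x∈ → h (there x∈)))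
... | false = mk⇔ (λ ()) (λ h → subst T fx (h (here refl)))

ints : ℕ → ℕ → List ℕ
ints a zero = []
ints a (suc k) = a ∷ ints (suc a) k

-- range a c = a, a + 1, …, c − 1; empty when c ≤ a, by truncated subtraction.
range : ℕ → ℕ → List ℕ
range a c = ints a (c ∸ a)

ints-++ : ∀ a k l → ints a (k + l) ≡ ints a k ++ ints (a + k) l
ints-++ a zero l = cong (λ b → ints b l) (sym (+-identityʳ a))
ints-++ a (suc k) l =
  cong (a ∷_) (trans (ints-++ (suc a) k l) (cong (λ b → ints (suc a) k ++ ints b l) (sym (+-suc a k))))

length-ints : ∀ a k → length (ints a k) ≡ k
length-ints a zero = refl
length-ints a (suc k) = cong suc (length-ints (suc a) k)

∈-ints⁻ : ∀ {j} a k → j ∈ ints a k → a ≤ j × j < a + k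
∈-ints⁻ a (suc k) (here refl) = ≤-refl , m<m+n a z<s
∈-ints⁻ {j} a (suc k) (there j∈) with a<j , j< ← ∈-ints⁻ (suc a) k j∈ =
  <⇒≤ a<j , subst (j <_) (sym (+-suc a k)) j<

∈-ints⁺ : ∀ {j} a k → a ≤ j → j < a + k → j ∈ ints a k
∈-ints⁺ {j} a zero a≤j j<a+0 = ⊥-elim (<⇒≱ (subst (j <_) (+-identityʳ a) j<a+0) a≤j)
∈-ints⁺ {j} a (suc k) a≤j j< with m≤n⇒m<n∨m≡n a≤j
... | inj₂ refl = here refl
... | inj₁ a<j = there (∈-ints⁺ (suc a) k a<j (subst (j <_) (+-suc a k) j<))

range-split : ∀ {a b c} → a ≤ b → b ≤ c → range a c ≡ range a b ++ range b c
range-split {a} {b} {c} a≤b b≤c = begin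
  ints a (c ∸ a)                              ≡⟨ cong (ints a) gap ⟩
  ints a ((b ∸ a) + (c ∸ b))                  ≡⟨ ints-++ a (b ∸ a) (c ∸ b) ⟩
  ints a (b ∸ a) ++ ints (a + (b ∸ a)) (c ∸ b) ≡⟨ cong (λ d → range a b ++ ints d (c ∸ b)) (m+[n∸m]≡n a≤b) ⟩
  range a b ++ range b c                      ∎
  where
  open ≡-Reasoning
  gap : c ∸ a ≡ (b ∸ a) + (c ∸ b)
  gap = begin
    c ∸ a             ≡⟨ cong (_∸ a) (sym (m∸n+n≡m b≤c)) ⟩
    (c ∸ b) + b ∸ a   ≡⟨ +-∸-assoc (c ∸ b) a≤b ⟩
    (c ∸ b) + (b ∸ a) ≡⟨ +-comm (c ∸ b) (b ∸ a) ⟩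
    (b ∸ a) + (c ∸ b) ∎

range-head : ∀ {a c} → a < c → range a c ≡ a ∷ range (suc a) c
range-head {a} {suc c} (s≤s a≤c) = cong (ints a) (+-∸-assoc 1 a≤c)

range-single : ∀ a → range a (suc a) ≡ a ∷ []
range-single a = cong (ints a) (m+n∸n≡m 1 a)

range-snoc : ∀ {a c} → a ≤ c → range a (suc c) ≡ range a c ++ c ∷ []
range-snoc {a} {c} a≤c = trans (range-split a≤c (n≤1+n c)) (cong (range a c ++_) (range-single c))

∈-range⁻ : ∀ {j a c} → j ∈ range a c → a ≤ j × j < c
∈-range⁻ {j} {a} {c} j∈ with a ≤? c
... | yes a≤c = let a≤j , j< = ∈-ints⁻ a (c ∸ a) j∈ in a≤j , subst (j <_) (m+[n∸m]≡n a≤c) j<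
... | no a≰c = ⊥-elim (¬Any[] (subst (λ k → j ∈ ints a k) (m≤n⇒m∸n≡0 (<⇒≤ (≰⇒> a≰c))) j∈))

∈-range⁺ : ∀ {j a c} → a ≤ j → j < c → j ∈ range a c
∈-range⁺ {j} {a} {c} a≤j j<c =
  ∈-ints⁺ a (c ∸ a) a≤j (subst (j <_) (sym (m+[n∸m]≡n (≤-trans a≤j (<⇒≤ j<c)))) j<c)

All-range : ∀ {Q : ℕ → Set} a c → (∀ {j} → a ≤ j → j < c → Q j) → All Q (range a c)
All-range a c h = All.tabulate λ j∈ → let a≤j , j<c = ∈-range⁻ j∈ in h a≤j j<c

module Extremal (g : ℕ → Bool) where

  Least : ℕ → Set
  Least a = ∃[ m ] m ≤ a × T (g m) × (∀ {j} → j < m → ¬ T (g j))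

  least : ∀ {a} → T (g a) → Least a
  least {a} = <-rec (λ a → T (g a) → Least a) step a
    where
    step : ∀ a → (∀ {j} → j < a → T (g j) → Least j) → T (g a) → Least a
    step a rec ga with anyUpTo? (T? ∘ g) a
    ... | no none = a , ≤-refl , ga , λ j<a gj → none (_ , j<a , gj)
    ... | yes (j , j<a , gj) with m , m≤j , gm , below ← rec j<a gj = m , ≤-trans m≤j (<⇒≤ j<a) , gm , below

  greatest : ∀ k {a} → a < k → T (g a) →
    ∃[ M ] a ≤ M × M < k × T (g M) × (∀ {j} → M < j → j < k → ¬ T (g j))
  greatest (suc k) {a} a<1+k ga with T? (g k) | m≤n⇒m<n∨m≡n (≤-pred a<1+k)
  ... | yes gk | _ = k , ≤-pred a<1+k , ≤-refl , gk , λ k<j j<1+k _ → <⇒≱ k<j (≤-pred j<1+k)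
  ... | no ¬gk | inj₂ refl = ⊥-elim (¬gk ga)
  ... | no ¬gk | inj₁ a<k with M , a≤M , M<k , gM , above ← greatest k a<k ga =
    M , a≤M , m<n⇒m<1+n M<k , gM , λ M<j j<1+k →
      [ above M<j , (λ { refl → ¬gk }) ]′ (m≤n⇒m<n∨m≡n (≤-pred j<1+k))

-- Dyck paths and the parenthesis matching

data Path : ℕ → Word → ℕ → Set where
  done : ∀ {h} → Path h [] h
  up   : ∀ {h w h′} → Path (suc h) w h′ → Path h (U ∷ w) h′
  down : ∀ {h w h′} → Path h w h′ → Path (suc h) (R ∷ w) h′

Dyck : Word → Set
Dyck w = Path 0 w 0

path-++ : ∀ {a b c u v} → Path a u b → Path b v c → Path a (u ++ v) c
path-++ done q = q
path-++ (up p) q = up (path-++ p q)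
path-++ (down p) q = down (path-++ p q)

path-split : ∀ {a c} u {v} → Path a (u ++ v) c → ∃[ b ] Path a u b × Path b v c
path-split [] p = _ , done , p
path-split (true ∷ u) (up p) with b , p₁ , p₂ ← path-split u p = b , up p₁ , p₂
path-split (false ∷ u) (down p) with b , p₁ , p₂ ← path-split u p = b , down p₁ , p₂

path-lift : ∀ {a w b} → Path a w b → Path (suc a) w (suc b)
path-lift done = done
path-lift (up p) = up (path-lift p)
path-lift (down p) = down (path-lift p)

dyck-lift : ∀ h {w} → Dyck w → Path h w h
dyck-lift zero d = d
dyck-lift (suc h) d = path-lift (dyck-lift h d)

path-unique : ∀ {a w b c} → Path a w b → Path a w c → b ≡ c
path-unique done done = refl
path-unique (up p) (up q) = path-unique p q
path-unique (down p) (down q) = path-unique p q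

dyck-D : ∀ k → Dyck (D k)
dyck-D k = up (closing (k ∸ 1))
  where
  closing : ∀ j → Path 1 (UR^ j ++ R ∷ []) 0
  closing zero = down done
  closing (suc j) = up (down (closing j))

dyck-insertAfter : ∀ p {v w} → Dyck v → Dyck w → Dyck (insertAfter p v w)
dyck-insertAfter p {v} {w} dv dw
  with h , p₁ , p₂ ← path-split (take p w) (subst (λ u → Dyck u) (sym (take++drop≡id p w)) dw)
  = path-++ p₁ (path-++ (dyck-lift h dv) p₂)

dyck-insertions : ∀ {A : Set} (pos size : A → ℕ) xs {w} → Dyck w →
  Dyck (foldl (λ u x → insertAfter (pos x) (D (size x)) u) w xs)
dyck-insertions pos size [] d = d
dyck-insertions pos size (x ∷ xs) d =
  dyck-insertions pos size xs (dyck-insertAfter (pos x) (dyck-D (size x)) d)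

matchGo-++ : ∀ {k w k′} → Path k w k′ → ∀ p xs → length xs ≡ k →
  ∃[ ys ] length ys ≡ k′ ×
    (∀ v s → matchGo (w ++ v) p (xs ++ s) ≡ matchGo w p xs ++ matchGo v (p + length w) (ys ++ s))
matchGo-++ done p xs refl = xs , refl , λ v s → cong (λ q → matchGo v q (xs ++ s)) (sym (+-identityʳ p))
matchGo-++ {w = U ∷ w} (up q) p xs refl with ys , len , eq ← matchGo-++ q (suc p) (p ∷ xs) refl =
  ys , len , λ v s → trans (eq v s)
    (cong (λ r → matchGo w (suc p) (p ∷ xs) ++ matchGo v r (ys ++ s)) (sym (+-suc p (length w))))
matchGo-++ {w = R ∷ w} (down q) p (x ∷ xs) refl with ys , len , eq ← matchGo-++ q (suc p) xs refl =
  ys , len , λ v s → cong ((x , p) ∷_) (trans (eq v s)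
    (cong (λ r → matchGo w (suc p) xs ++ matchGo v r (ys ++ s)) (sym (+-suc p (length w)))))

matchGo-dyck-++ : ∀ {w} → Dyck w → ∀ p s v →
  matchGo (w ++ v) p s ≡ matchGo w p [] ++ matchGo v (p + length w) s
matchGo-dyck-++ d p s v with [] , refl , eq ← matchGo-++ d p [] refl = eq v s

φ-< : ∀ n {a} → a < 2 * n → φ n a ≡ suc a
φ-< n {a} a<2n = cong (if_then suc a else 1) (to T-≡ (<⇒<ᵇ a<2n))

φ-last : ∀ n → φ n (2 * n) ≡ 1
φ-last n = cong (if_then suc (2 * n) else 1) (¬T⇒≡false (<-irrefl refl ∘ <ᵇ⇒< (2 * n) (2 * n)))

σ-matchGo : ∀ n w p xs → All (_< 2 * n) xs → p + length w ≤ 2 * n →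
  σ n (matchGo w p xs) ≡ matchGo w (suc p) (map suc xs)
σ-matchGo n [] p xs _ _ = refl
σ-matchGo n (true ∷ w) p xs xs<2n bound =
  σ-matchGo n w (suc p) (p ∷ xs) (<-≤-trans (m<m+n p z<s) bound ∷ xs<2n)
    (subst (_≤ 2 * n) (+-suc p (length w)) bound)
σ-matchGo n (false ∷ w) p [] [] bound =
  σ-matchGo n w (suc p) [] [] (subst (_≤ 2 * n) (+-suc p (length w)) bound)
σ-matchGo n (false ∷ w) p (x ∷ xs) (x<2n ∷ xs<2n) bound =
  cong₂ _∷_ (cong₂ _,_ (φ-< n x<2n) (φ-< n (<-≤-trans (m<m+n p z<s) bound)))
    (σ-matchGo n w (suc p) xs xs<2n (subst (_≤ 2 * n) (+-suc p (length w)) bound))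

Paired-resp-↭ : ∀ {C D x y} → C ↭ D → Paired C x y → Paired D x y
Paired-resp-↭ p = Sum.map (∈-resp-↭ p) (∈-resp-↭ p)

Paired-flip : ∀ {a b C x y} → Paired ((a , b) ∷ C) x y → Paired ((b , a) ∷ C) x y
Paired-flip (inj₁ (here refl)) = inj₂ (here refl)
Paired-flip (inj₁ (there p)) = inj₁ (there p)
Paired-flip (inj₂ (here refl)) = inj₁ (here refl)
Paired-flip (inj₂ (there p)) = inj₂ (there p)

Paired-last⇔head : ∀ X Y {a b} x y →
  Paired (X ++ (Y ++ (a , b) ∷ [])) x y ⇔ Paired (X ++ (b , a) ∷ Y) x y
Paired-last⇔head X Y {a} {b} x y = mk⇔
  (Paired-resp-↭ (↭-sym (shift (b , a) X Y)) ∘ Paired-flip ∘ Paired-resp-↭ last↭head)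
  (Paired-resp-↭ (↭-sym last↭head) ∘ Paired-flip ∘ Paired-resp-↭ (shift (b , a) X Y))
  where
  last↭head : ∀ {e} → X ++ (Y ++ e ∷ []) ↭ e ∷ X ++ Y
  last↭head {e} = subst (_↭ e ∷ X ++ Y) (++-assoc X Y (e ∷ [])) (++-comm (X ++ Y) (e ∷ []))

rotation : ∀ n {A B} → Dyck A → Dyck B → length (A ++ U ∷ B ++ R ∷ []) ≡ 2 * n → ∀ x y →
  Paired (σ n (toMatching (A ++ U ∷ B ++ R ∷ []))) x y ⇔ Paired (toMatching (U ∷ A ++ R ∷ B)) x y
rotation n {A} {B} dA dB len x y =
  subst₂ (λ C C′ → Paired C x y ⇔ Paired C′ x y) (sym rotated) (sym opened)
    (Paired-last⇔head (matchGo A 2 []) (matchGo B (3 + a) []) x y)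
  where
  a b : ℕ
  a = length A
  b = length B
  open ≡-Reasoning

  last≡2n : 2 + a + b ≡ 2 * n
  last≡2n = begin
    2 + a + b                        ≡⟨ solve 2 (λ a b → con 2 :+ a :+ b := a :+ (con 1 :+ (b :+ con 1))) refl a b ⟩
    a + (1 + (b + 1))                ≡⟨ cong (λ l → a + suc l) (sym (length-++ B)) ⟩
    a + length (U ∷ B ++ R ∷ [])     ≡⟨ sym (length-++ A) ⟩
    length (A ++ U ∷ B ++ R ∷ [])    ≡⟨ len ⟩
    2 * n                            ∎
    where open +-*-Solver

  split : toMatching (A ++ U ∷ B ++ R ∷ []) ≡ matchGo A 1 [] ++ (matchGo B (2 + a) [] ++ (1 + a , 2 + a + b) ∷ [])
  split = trans (matchGo-dyck-++ dA 1 [] _)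
    (cong (matchGo A 1 [] ++_) (matchGo-dyck-++ dB (2 + a) (1 + a ∷ []) (R ∷ [])))

  rotated : σ n (toMatching (A ++ U ∷ B ++ R ∷ [])) ≡ matchGo A 2 [] ++ (matchGo B (3 + a) [] ++ (2 + a , 1) ∷ [])
  rotated = begin
    σ n (toMatching (A ++ U ∷ B ++ R ∷ []))
      ≡⟨ cong (σ n) split ⟩
    σ n (matchGo A 1 [] ++ (matchGo B (2 + a) [] ++ (1 + a , 2 + a + b) ∷ []))
      ≡⟨ trans (map-++ _ (matchGo A 1 []) _) (cong (σ n (matchGo A 1 []) ++_) (map-++ _ (matchGo B (2 + a) []) _)) ⟩
    σ n (matchGo A 1 []) ++ (σ n (matchGo B (2 + a) []) ++ (φ n (1 + a) , φ n (2 + a + b)) ∷ [])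
      ≡⟨ cong₂ _++_ (σ-matchGo n A 1 [] [] A-bound)
           (cong₂ (λ C e → C ++ e ∷ []) (σ-matchGo n B (2 + a) [] [] (≤-reflexive last≡2n))
             (cong₂ _,_ (φ-< n (<-≤-trans (n<1+n (1 + a)) A-bound′)) (trans (cong (φ n) last≡2n) (φ-last n)))) ⟩
    matchGo A 2 [] ++ (matchGo B (3 + a) [] ++ (2 + a , 1) ∷ []) ∎
    where
    A-bound′ : 2 + a ≤ 2 * n
    A-bound′ = ≤-trans (m≤m+n (2 + a) b) (≤-reflexive last≡2n)
    A-bound : 1 + a ≤ 2 * n
    A-bound = ≤-trans (n≤1+n (1 + a)) A-bound′

  opened : toMatching (U ∷ A ++ R ∷ B) ≡ matchGo A 2 [] ++ (1 , 2 + a) ∷ matchGo B (3 + a) []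
  opened = matchGo-dyck-++ dA 2 (1 ∷ []) (R ∷ B)

dyck-suffix : ∀ {A B} → Dyck A → Dyck (U ∷ A ++ R ∷ B) → Dyck B
dyck-suffix {A} dA (up p) with path-split A p
... | h , p₁ , p₂ with path-unique p₁ (path-lift dA) | p₂
...   | refl | down q = q

-- Blocks of a noncrossing partition of {0, …, n − 1}

record IsNCPartition (n : ℕ) (P : ℕ → ℕ → Bool) : Set where
  field
    bounded     : ∀ {i j} → T (P i j) → i < n × j < n
    reflexive   : ∀ {i} → i < n → T (P i i)
    symmetric   : ∀ {i j} → T (P i j) → T (P j i)
    transitive  : ∀ {i j k} → T (P i j) → T (P j k) → T (P i k)
    noncrossing : ∀ {i j k l} → i < j → j < k → k < l → T (P i k) → T (P j l) → T (P i j)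

Closed : (ℕ → ℕ → Bool) → ℕ → ℕ → Set
Closed P a b = ∀ {k l} → T (P k l) → a ≤ k → k < b → a ≤ l × l < b

interleave : (ℕ → Bool) → (ℕ → Bool) → List ℕ → Word
interleave f g [] = []
interleave f g (i ∷ is) = f i ∷ g i ∷ interleave f g is

interleave-++ : ∀ f g xs ys → interleave f g (xs ++ ys) ≡ interleave f g xs ++ interleave f g ys
interleave-++ f g [] ys = refl
interleave-++ f g (x ∷ xs) ys = cong (λ w → f x ∷ g x ∷ w) (interleave-++ f g xs ys)

length-interleave : ∀ f g xs → length (interleave f g xs) ≡ 2 * length xs
length-interleave f g [] = refl
length-interleave f g (x ∷ xs) = trans (cong (suc ∘ suc) (length-interleave f g xs)) (sym (*-suc 2 (length xs)))

interleave-chain : ∀ {f g} xs {M} → All (λ x → f x ≡ R × g x ≡ U) xs → f M ≡ R → g M ≡ R →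
  U ∷ interleave f g (xs ++ M ∷ []) ≡ UR^ (length (xs ++ M ∷ [])) ++ R ∷ []
interleave-chain [] [] fM gM = cong₂ (λ a b → U ∷ a ∷ b ∷ []) fM gM
interleave-chain {f} {g} (x ∷ xs) {M} ((fx , gx) ∷ rest) fM gM =
  cong₂ (λ a b → U ∷ a ∷ b) fx
    (trans (cong (λ b → b ∷ interleave f g (xs ++ M ∷ [])) gx) (interleave-chain xs rest fM gM))

filter-cong : ∀ {S S′ : ℕ → Bool} {xs} → All (λ x → S x ≡ S′ x) xs →
  filter (T? ∘ S) xs ≡ filter (T? ∘ S′) xs
filter-cong [] = refl
filter-cong {S′ = S′} {x ∷ xs} (eq ∷ eqs) rewrite eq with S′ x
... | true = cong (x ∷_) (filter-cong eqs)
... | false = filter-cong eqs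

insertAfter-length : ∀ xs v ys → insertAfter (length xs) v (xs ++ ys) ≡ xs ++ v ++ ys
insertAfter-length [] v ys = refl
insertAfter-length (x ∷ xs) v ys = cong (x ∷_) (insertAfter-length xs v ys)

module Blocks {n : ℕ} {P : ℕ → ℕ → Bool} (isNC : IsNCPartition n P) where
  open IsNCPartition isNC

  isMin : ℕ → Bool
  isMin i = allB (λ j → not (P i j)) (range 0 i)

  isMax : ℕ → Bool
  isMax i = allB (λ j → not (P i j)) (range (suc i) n)

  notMax : ℕ → Bool
  notMax i = not (isMax i)

  isMin⇔ : ∀ {i} → T (isMin i) ⇔ (∀ {j} → j < i → ¬ T (P i j))
  isMin⇔ {i} = mk⇔
    (λ t {j} j<i → to T-not (to (T-allB _ (range 0 i)) t (∈-range⁺ z≤n j<i)))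
    (λ h → from (T-allB _ (range 0 i)) (λ j∈ → from T-not (h (proj₂ (∈-range⁻ j∈)))))

  isMax⇔ : ∀ {i} → T (isMax i) ⇔ (∀ {j} → i < j → ¬ T (P i j))
  isMax⇔ {i} = mk⇔
    (λ t {j} i<j Pij → to T-not (to (T-allB _ (range (suc i) n)) t (∈-range⁺ i<j (proj₂ (bounded Pij)))) Pij)
    (λ h → from (T-allB _ (range (suc i) n)) (λ j∈ → from T-not (h (proj₁ (∈-range⁻ {c = n} j∈)))))

  blockMin : ∀ {i} → i < n → ∃[ b ] b ≤ i × T (P i b) × T (isMin b)
  blockMin {i} i<n with b , b≤i , Pib , below ← Extremal.least (P i) (reflexive i<n) =
    b , b≤i , Pib , from isMin⇔ (λ j<b Pbj → below j<b (transitive Pib Pbj))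

  blockMax : ∀ {i} → i < n → ∃[ M ] i ≤ M × T (P i M) × T (isMax M)
  blockMax {i} i<n with M , i≤M , _ , PiM , above ← Extremal.greatest (P i) n i<n (reflexive i<n) =
    M , i≤M , PiM , from isMax⇔ (λ M<j PMj → above M<j (proj₂ (bounded PMj)) (transitive PiM PMj))

  nonMin-witness : ∀ {i} → i < n → ¬ T (isMin i) → ∃[ j ] j < i × T (P i j)
  nonMin-witness i<n ¬min with b , b≤i , Pib , min-b ← blockMin i<n with m≤n⇒m<n∨m≡n b≤i
  ... | inj₁ b<i = b , b<i , Pib
  ... | inj₂ refl = ⊥-elim (¬min min-b)

  nonMax-witness : ∀ {i} → i < n → ¬ T (isMax i) → ∃[ j ] i < j × T (P i j)
  nonMax-witness i<n ¬max with M , i≤M , PiM , max-M ← blockMax i<n with m≤n⇒m<n∨m≡n i≤M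
  ... | inj₁ i<M = M , i<M , PiM
  ... | inj₂ refl = ⊥-elim (¬max max-M)

  min-unique : ∀ {a b} → T (P a b) → T (isMin a) → T (isMin b) → a ≡ b
  min-unique {a} {b} Pab min-a min-b with <-cmp a b
  ... | tri< a<b _ _ = ⊥-elim (to isMin⇔ min-b a<b (symmetric Pab))
  ... | tri≈ _ a≡b _ = a≡b
  ... | tri> _ _ b<a = ⊥-elim (to isMin⇔ min-a b<a Pab)

  block-closed : ∀ {a c} → T (P a c) → T (isMin a) → T (isMax c) → Closed P a (suc c)
  block-closed {a} {c} Pac min-a max-c {k} {l} Pkl a≤k k≤c =
    ≮⇒≥ (λ l<a → to isMin⇔ min-a l<a (left l<a)) ,
    s≤s (≮⇒≥ (λ c<l → to isMax⇔ max-c c<l (transitive (symmetric Pac) (right c<l))))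
    where
    left : l < a → T (P a l)
    left l<a with m≤n⇒m<n∨m≡n a≤k | m≤n⇒m<n∨m≡n (≤-pred k≤c)
    ... | inj₂ refl | _ = Pkl
    ... | inj₁ _ | inj₂ refl = transitive Pac Pkl
    ... | inj₁ a<k | inj₁ k<c = symmetric (noncrossing l<a a<k k<c (symmetric Pkl) Pac)
    right : c < l → T (P a l)
    right c<l with m≤n⇒m<n∨m≡n a≤k | m≤n⇒m<n∨m≡n (≤-pred k≤c)
    ... | inj₂ refl | _ = Pkl
    ... | inj₁ _ | inj₂ refl = transitive Pac Pkl
    ... | inj₁ a<k | inj₁ k<c = transitive (noncrossing a<k k<c c<l Pac Pkl) Pkl

  closed-all : Closed P 0 n
  closed-all Pkl _ _ = z≤n , proj₂ (bounded Pkl)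

  letters : List ℕ → Word
  letters = interleave isMin notMax

  blockCard : ℕ → ℕ
  blockCard t = length (filter (T? ∘ P t) (range 0 n))

  step : Word → ℕ → Word
  step w t = insertAfter (2 * t) (D (blockCard t)) w

  minima : ℕ → List ℕ
  minima t = filter (T? ∘ isMin) (range 0 t)

  covered : ℕ → ℕ → Bool
  covered zero j = false
  covered (suc t) j = covered t j ∨ P t j

  covered⁺ : ∀ {t k j} → k < t → T (P k j) → T (covered t j)
  covered⁺ {suc t} {k} {j} k<1+t Pkj with m≤n⇒m<n∨m≡n (≤-pred k<1+t)
  ... | inj₁ k<t = from T-∨ (inj₁ (covered⁺ k<t Pkj))
  ... | inj₂ refl = from T-∨ (inj₂ Pkj)

  covered⁻ : ∀ {t j} → T (covered t j) → ∃[ k ] k < t × T (P k j)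
  covered⁻ {suc t} {j} c with to (T-∨ {covered t j}) c
  ... | inj₁ c′ with k , k<t , Pkj ← covered⁻ c′ = k , m<n⇒m<1+n k<t , Pkj
  ... | inj₂ Ptj = t , ≤-refl , Ptj

  word : (ℕ → Bool) → Word
  word S = letters (filter (T? ∘ S) (range 0 n))

  word-cong : ∀ {S S′} → (∀ j → S j ≡ S′ j) → word S ≡ word S′
  word-cong eq = cong letters (filter-cong {xs = range 0 n} (All.tabulate (λ {j} _ → eq j)))

  isMin≡false : ∀ {i j} → j < i → T (P i j) → isMin i ≡ false
  isMin≡false j<i Pij = ¬T⇒≡false (λ min-i → to isMin⇔ min-i j<i Pij)

  notMax≡true : ∀ {i j} → i < j → T (P i j) → notMax i ≡ true
  notMax≡true i<j Pij = cong not (¬T⇒≡false (λ max-i → to isMax⇔ max-i i<j Pij))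

  module InsertBlock {t M : ℕ} (min-t : T (isMin t)) (t≤M : t ≤ M) (PtM : T (P t M)) (max-M : T (isMax M)) where
    t<n : t < n
    t<n = proj₁ (bounded PtM)

    hull : Closed P t (suc M)
    hull = block-closed PtM min-t max-M

    beyond : ∀ {j} → M < j → ¬ T (P t j)
    beyond M<j Ptj = to isMax⇔ max-M M<j (transitive (symmetric PtM) Ptj)

    hull-uncovered : ∀ {j} → t ≤ j → j < suc M → ¬ T (covered t j)
    hull-uncovered t≤j j≤M c with k , k<t , Pkj ← covered⁻ c = <⇒≱ k<t (proj₁ (hull (symmetric Pkj) t≤j j≤M))

    below within above : (ℕ → Bool) → List ℕ
    below S = filter (T? ∘ S) (range 0 t)
    within S = filter (T? ∘ S) (range t (suc M))
    above S = filter (T? ∘ S) (range (suc M) n)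

    Block : List ℕ
    Block = within (P t)

    Pre Post : Word
    Pre = letters (range 0 t)
    Post = letters (above (covered t))

    filter-pieces : ∀ S → filter (T? ∘ S) (range 0 n) ≡ below S ++ within S ++ above S
    filter-pieces S = begin
      filter (T? ∘ S) (range 0 n)
        ≡⟨ cong (filter (T? ∘ S)) (range-split z≤n (<⇒≤ t<n)) ⟩
      filter (T? ∘ S) (range 0 t ++ range t n)
        ≡⟨ filter-++ (T? ∘ S) (range 0 t) _ ⟩
      below S ++ filter (T? ∘ S) (range t n)
        ≡⟨ cong (λ xs → below S ++ filter (T? ∘ S) xs) (range-split (m≤n⇒m≤1+n t≤M) (proj₂ (bounded PtM))) ⟩
      below S ++ filter (T? ∘ S) (range t (suc M) ++ range (suc M) n)
        ≡⟨ cong (below S ++_) (filter-++ (T? ∘ S) (range t (suc M)) _) ⟩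
      below S ++ within S ++ above S ∎
      where open ≡-Reasoning

    word-pieces : ∀ S → word S ≡ letters (below S) ++ letters (within S) ++ letters (above S)
    word-pieces S = begin
      letters (filter (T? ∘ S) (range 0 n))           ≡⟨ cong letters (filter-pieces S) ⟩
      letters (below S ++ within S ++ above S)          ≡⟨ interleave-++ _ _ (below S) _ ⟩
      letters (below S) ++ letters (within S ++ above S) ≡⟨ cong (letters (below S) ++_) (interleave-++ _ _ (within S) _) ⟩
      letters (below S) ++ letters (within S) ++ letters (above S) ∎
      where open ≡-Reasoning

    below-all : ∀ {S} → (∀ {j} → T (covered t j) → T (S j)) → below S ≡ range 0 t
    below-all cov⇒S = filter-all _ (All-range 0 t (λ _ j<t → cov⇒S (covered⁺ j<t (reflexive (<-trans j<t t<n)))))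

    word-before : word (covered t) ≡ Pre ++ Post
    word-before = trans (word-pieces (covered t))
      (cong₂ (λ u v → letters u ++ letters v ++ Post) (below-all id) (filter-none _ (All-range t (suc M) hull-uncovered)))

    word-after : word (covered (suc t)) ≡ Pre ++ letters Block ++ Post
    word-after = trans (word-pieces (covered (suc t)))
      (cong₂ (λ u v → letters u ++ v) (below-all (from T-∨ ∘ inj₁))
        (cong₂ (λ u v → letters u ++ letters v) (filter-cong (All-range t (suc M) inside))
                                                (filter-cong (All-range (suc M) n outside))))
      where
      inside : ∀ {j} → t ≤ j → j < suc M → covered (suc t) j ≡ P t j
      inside t≤j j≤M = cong (_∨ P t _) (¬T⇒≡false (hull-uncovered t≤j j≤M))
      outside : ∀ {j} → suc M ≤ j → j < n → covered (suc t) j ≡ covered t j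
      outside M<j _ = trans (cong (covered t _ ∨_) (¬T⇒≡false (beyond M<j))) (∨-identityʳ _)

    card : blockCard t ≡ length Block
    card = cong length (trans (filter-pieces (P t))
      (trans (cong₂ (λ u v → u ++ Block ++ v) (filter-none _ (All-range 0 t (λ _ j<t → to isMin⇔ min-t j<t)))
                                             (filter-none _ (All-range (suc M) n (λ M<j _ → beyond M<j))))
             (++-identityʳ Block)))

    block-letters : letters Block ≡ D (length Block)
    block-letters with m≤n⇒m<n∨m≡n t≤M
    ... | inj₂ refl = subst (λ xs → letters xs ≡ D (length xs)) (sym singleton)
          (cong₂ (λ a b → a ∷ b ∷ []) (to T-≡ min-t) (cong not (to T-≡ max-M)))
      where
      singleton : Block ≡ t ∷ []
      singleton = trans (cong (filter (T? ∘ P t)) (range-single t)) (filter-accept (T? ∘ P t) PtM)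
    ... | inj₁ t<M = subst (λ xs → letters xs ≡ D (length xs)) (sym chain)
          (cong₂ _∷_ (to T-≡ min-t) (trans (cong (_∷ letters (Inner ++ M ∷ [])) (notMax≡true t<M PtM))
            (interleave-chain Inner (All.tabulate interior) (isMin≡false t<M (symmetric PtM)) (cong not (to T-≡ max-M)))))
      where
      Inner : List ℕ
      Inner = filter (T? ∘ P t) (range (suc t) M)
      chain : Block ≡ t ∷ Inner ++ M ∷ []
      chain = begin
        Block                                         ≡⟨ cong (filter (T? ∘ P t)) (trans (range-head (s≤s t≤M)) (cong (t ∷_) (range-snoc t<M))) ⟩
        filter (T? ∘ P t) (t ∷ range (suc t) M ++ M ∷ []) ≡⟨ filter-accept (T? ∘ P t) (reflexive t<n) ⟩
        t ∷ filter (T? ∘ P t) (range (suc t) M ++ M ∷ []) ≡⟨ cong (t ∷_) (filter-++ (T? ∘ P t) (range (suc t) M) _) ⟩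
        t ∷ Inner ++ filter (T? ∘ P t) (M ∷ [])        ≡⟨ cong (λ xs → t ∷ Inner ++ xs) (filter-accept (T? ∘ P t) PtM) ⟩
        t ∷ Inner ++ M ∷ []                            ∎
        where open ≡-Reasoning
      interior : ∀ {x} → x ∈ Inner → isMin x ≡ R × notMax x ≡ U
      interior x∈ with x∈range , Ptx ← ∈-filter⁻ (T? ∘ P t) x∈ with t<x , x<M ← ∈-range⁻ x∈range =
        isMin≡false t<x (symmetric Ptx) , notMax≡true x<M (transitive (symmetric Ptx) PtM)

    insertion : step (word (covered t)) t ≡ word (covered (suc t))
    insertion = begin
      insertAfter (2 * t) (D (blockCard t)) (word (covered t))
        ≡⟨ cong₂ (λ p w → insertAfter p (D (blockCard t)) w) (sym length-Pre) word-before ⟩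
      insertAfter (length Pre) (D (blockCard t)) (Pre ++ Post)
        ≡⟨ insertAfter-length Pre _ Post ⟩
      Pre ++ D (blockCard t) ++ Post
        ≡⟨ cong (λ w → Pre ++ w ++ Post) (trans (cong D card) (sym block-letters)) ⟩
      Pre ++ letters Block ++ Post
        ≡⟨ sym word-after ⟩
      word (covered (suc t)) ∎
      where
      open ≡-Reasoning
      length-Pre : length Pre ≡ 2 * t
      length-Pre = trans (length-interleave _ _ (range 0 t)) (cong (2 *_) (length-ints 0 t))

  insert-block : ∀ {t} → t < n → T (isMin t) → step (word (covered t)) t ≡ word (covered (suc t))
  insert-block t<n min-t with M , t≤M , PtM , max-M ← blockMax t<n = InsertBlock.insertion min-t t≤M PtM max-M

  covered-skip : ∀ {t} → t < n → ¬ T (isMin t) → ∀ j → covered t j ≡ covered (suc t) j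
  covered-skip {t} t<n ¬min j with k , k<t , Ptk ← nonMin-witness t<n ¬min =
    T-injective (mk⇔ (from T-∨ ∘ inj₁) ([ id , covered-via-k ]′ ∘ to T-∨))
    where
    covered-via-k : T (P t j) → T (covered t j)
    covered-via-k Ptj = covered⁺ k<t (transitive (symmetric Ptk) Ptj)

  stage : ∀ {t} → t ≤ n → foldl step [] (minima t) ≡ word (covered t)
  stage {zero} _ = sym (cong letters (filter-none (T? ∘ covered 0) (All-range 0 n (λ _ _ ()))))
  stage {suc t} t<n = begin
    foldl step [] (minima (suc t))
      ≡⟨ cong (foldl step [])
           (trans (cong (filter (T? ∘ isMin)) (range-snoc {0} {t} z≤n)) (filter-++ (T? ∘ isMin) (range 0 t) _)) ⟩
    foldl step [] (minima t ++ filter (T? ∘ isMin) (t ∷ []))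
      ≡⟨ foldl-++ step [] (minima t) _ ⟩
    foldl step (foldl step [] (minima t)) (filter (T? ∘ isMin) (t ∷ []))
      ≡⟨ cong (λ w → foldl step w (filter (T? ∘ isMin) (t ∷ []))) (stage (<⇒≤ t<n)) ⟩
    foldl step (word (covered t)) (filter (T? ∘ isMin) (t ∷ []))
      ≡⟨ last-step ⟩
    word (covered (suc t)) ∎
    where
    open ≡-Reasoning
    last-step : foldl step (word (covered t)) (filter (T? ∘ isMin) (t ∷ [])) ≡ word (covered (suc t))
    last-step with T? (isMin t)
    ... | yes min-t =
      trans (cong (foldl step _) (filter-accept (T? ∘ isMin) {x = t} {xs = []} min-t)) (insert-block t<n min-t)
    ... | no ¬min =
      trans (cong (foldl step _) (filter-reject (T? ∘ isMin) {x = t} {xs = []} ¬min)) (word-cong (covered-skip t<n ¬min))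

  word-closed : ∀ {b} → b ≤ n → Closed P 0 b → word (covered b) ≡ letters (range 0 b)
  word-closed {b} b≤n closed = cong letters (begin
    filter (T? ∘ covered b) (range 0 n)
      ≡⟨ cong (filter (T? ∘ covered b)) (range-split z≤n b≤n) ⟩
    filter (T? ∘ covered b) (range 0 b ++ range b n)
      ≡⟨ filter-++ (T? ∘ covered b) (range 0 b) _ ⟩
    filter (T? ∘ covered b) (range 0 b) ++ filter (T? ∘ covered b) (range b n)
      ≡⟨ cong₂ _++_ (filter-all _ (All-range 0 b (λ _ j<b → covered⁺ j<b (reflexive (<-≤-trans j<b b≤n)))))
                    (filter-none _ (All-range b n (λ b≤j _ → uncovered b≤j))) ⟩
    range 0 b ++ []
      ≡⟨ ++-identityʳ _ ⟩
    range 0 b ∎)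
    where
    open ≡-Reasoning
    uncovered : ∀ {j} → b ≤ j → ¬ T (covered b j)
    uncovered b≤j c with k , k<b , Pkj ← covered⁻ c = <⇒≱ (proj₂ (closed Pkj z≤n k<b)) b≤j

  dyck-prefix : ∀ {b} → b ≤ n → Closed P 0 b → Dyck (letters (range 0 b))
  dyck-prefix {b} b≤n closed =
    subst Dyck (trans (stage b≤n) (word-closed b≤n closed)) (dyck-insertions (2 *_) blockCard (minima b) done)

  insertions≡letters : foldl step [] (minima n) ≡ letters (range 0 n)
  insertions≡letters = trans (stage ≤-refl) (word-closed ≤-refl closed-all)

-- The Kreweras complement

SameRegion : (ℕ → ℕ → Bool) → ℕ → ℕ → Set
SameRegion P i j = (i ≤ j → Closed P i j) × (j ≤ i → Closed P j i)

closed-empty : ∀ P a → Closed P a a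
closed-empty P a _ a≤k k<a = ⊥-elim (<⇒≱ k<a a≤k)

SameRegion-intro : ∀ {P a b} → a ≤ b → Closed P a b → SameRegion P a b
SameRegion-intro {P} {a} a≤b closed =
  (λ _ → closed) , (λ b≤a → subst (λ c → Closed P c a) (≤-antisym a≤b b≤a) (closed-empty P a))

module ClosedArcs {n : ℕ} {P : ℕ → ℕ → Bool} (isNC : IsNCPartition n P) where
  open IsNCPartition isNC using (symmetric)

  closed-∪ : ∀ {a b c} → a ≤ b → b ≤ c → Closed P a b → Closed P b c → Closed P a c
  closed-∪ {b = b} a≤b b≤c ab bc {k} Pkl a≤k k<c with k <? b
  ... | yes k<b = let a≤l , l<b = ab Pkl a≤k k<b in a≤l , <-≤-trans l<b b≤c
  ... | no k≮b = let b≤l , l<c = bc Pkl (≮⇒≥ k≮b) k<c in ≤-trans a≤b b≤l , l<c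

  closed-∖ˡ : ∀ {a b c} → a ≤ b → Closed P a c → Closed P a b → Closed P b c
  closed-∖ˡ {b = b} a≤b ac ab {k} {l} Pkl b≤k k<c with a≤l , l<c ← ac Pkl (≤-trans a≤b b≤k) k<c | l <? b
  ... | yes l<b = ⊥-elim (<⇒≱ (proj₂ (ab (symmetric Pkl) a≤l l<b)) b≤k)
  ... | no l≮b = ≮⇒≥ l≮b , l<c

  closed-∖ʳ : ∀ {a b c} → b ≤ c → Closed P a c → Closed P b c → Closed P a b
  closed-∖ʳ {b = b} b≤c ac bc {k} {l} Pkl a≤k k<b with a≤l , l<c ← ac Pkl a≤k (<-≤-trans k<b b≤c) | l <? b
  ... | yes l<b = a≤l , l<b
  ... | no l≮b = ⊥-elim (<⇒≱ k<b (proj₁ (bc (symmetric Pkl) (≮⇒≥ l≮b) l<c)))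

  closed-∩ : ∀ {a b c d} → a ≤ b → c ≤ d → Closed P a c → Closed P b d → Closed P b c
  closed-∩ a≤b c≤d ac bd Pkl b≤k k<c =
    proj₁ (bd Pkl b≤k (<-≤-trans k<c c≤d)) , proj₂ (ac Pkl (≤-trans a≤b b≤k) k<c)

  closed-through : ∀ {x y z} → SameRegion P x y → SameRegion P y z → x ≤ z → Closed P x z
  closed-through {x} {y} {z} (xy , yx) (yz , zy) x≤z with ≤-total y x | ≤-total y z
  ... | inj₁ y≤x | _ = closed-∖ˡ y≤x (yz (≤-trans y≤x x≤z)) (yx y≤x)
  ... | inj₂ x≤y | inj₁ y≤z = closed-∪ x≤y y≤z (xy x≤y) (yz y≤z)
  ... | inj₂ x≤y | inj₂ z≤y = closed-∖ʳ z≤y (xy x≤y) (zy z≤y)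

  SameRegion-trans : ∀ {x y z} → SameRegion P x y → SameRegion P y z → SameRegion P x z
  SameRegion-trans xy yz = closed-through xy yz , closed-through (swap yz) (swap xy)

before : (ℕ → Bool) → ℕ → Bool
before g zero = U
before g (suc i) = g i

interleave-shift : ∀ f g a k →
  before g a ∷ interleave f g (ints a k) ≡ interleave (before g) f (ints a k) ++ before g (k + a) ∷ []
interleave-shift f g a zero = refl
interleave-shift f g a (suc k) =
  cong (λ w → before g a ∷ f a ∷ w) (trans (interleave-shift f g (suc a) k)
    (cong (λ i → interleave (before g) f (ints (suc a) k) ++ before g i ∷ []) (+-suc k a)))

interleave-shift-range : ∀ f g {a c} → a ≤ c →
  before g a ∷ interleave f g (range a c) ≡ interleave (before g) f (range a c) ++ before g c ∷ []
interleave-shift-range f g {a} {c} a≤c =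
  trans (interleave-shift f g a (c ∸ a))
    (cong (λ i → interleave (before g) f (range a c) ++ before g i ∷ []) (m∸n+n≡m a≤c))

module Kreweras {m : ℕ} {P P′ : ℕ → ℕ → Bool} (isNC : IsNCPartition (suc m) P)
  (P′⇔ : ∀ {i j} → T (P′ i j) ⇔ (i < suc m × j < suc m × SameRegion P i j)) where
  open IsNCPartition isNC
  open ClosedArcs isNC
  module N = Blocks isNC

  region : ∀ {i j} → T (P′ i j) → SameRegion P i j
  region = proj₂ ∘ proj₂ ∘ to P′⇔

  P′-intro : ∀ {i j} → i < suc m → j < suc m → SameRegion P i j → T (P′ i j)
  P′-intro i<n j<n r = from P′⇔ (i<n , j<n , r)

  isNC′ : IsNCPartition (suc m) P′
  isNC′ = record
    { bounded     = λ p → let i<n , j<n , _ = to P′⇔ p in i<n , j<n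
    ; reflexive   = λ {i} i<n → P′-intro i<n i<n (SameRegion-intro ≤-refl (closed-empty P i))
    ; symmetric   = λ p → let i<n , j<n , r = to P′⇔ p in P′-intro j<n i<n (swap r)
    ; transitive  = λ p q → let i<n , _ , r = to P′⇔ p ; _ , k<n , s = to P′⇔ q in
                      P′-intro i<n k<n (SameRegion-trans r s)
    ; noncrossing = noncrossing′
    }
    where
    noncrossing′ : ∀ {i j k l} → i < j → j < k → k < l → T (P′ i k) → T (P′ j l) → T (P′ i j)
    noncrossing′ {i} {j} {k} {l} i<j j<k k<l ik jl
      with i<n , _ , ik-region ← to P′⇔ ik | j<n , _ , jl-region ← to P′⇔ jl =
      P′-intro i<n j<n (SameRegion-intro (<⇒≤ i<j) (closed-∖ʳ (<⇒≤ j<k) i⋯k j⋯k))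
      where
      i⋯k : Closed P i k
      i⋯k = proj₁ ik-region (<⇒≤ (<-trans i<j j<k))
      j⋯k : Closed P j k
      j⋯k = closed-∩ (<⇒≤ i<j) (<⇒≤ k<l) i⋯k (proj₁ jl-region (<⇒≤ (<-trans j<k k<l)))

  module N′ = Blocks isNC′

  max-last : T (N.isMax m)
  max-last = from N.isMax⇔ (λ m<j Pmj → <⇒≱ m<j (≤-pred (proj₂ (bounded Pmj))))

  isMin′≡before : ∀ {i} → i < suc m → N′.isMin i ≡ before N.notMax i
  isMin′≡before {zero} _ = refl
  isMin′≡before {suc i} 1+i<n = ≡not-intro max⇒¬min′ ¬max⇒min′
    where
    i<n : i < suc m
    i<n = <-trans (n<1+n i) 1+i<n
    max⇒¬min′ : T (N.isMax i) → ¬ T (N′.isMin (suc i))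
    max⇒¬min′ max-i min′ with b , b≤i , Pib , min-b ← N.blockMin i<n =
      to N′.isMin⇔ min′ (s≤s b≤i) (P′-intro 1+i<n (≤-<-trans b≤i i<n)
        (swap (SameRegion-intro (m≤n⇒m≤1+n b≤i) (N.block-closed (symmetric Pib) min-b max-i))))
    ¬max⇒min′ : ¬ T (N.isMax i) → T (N′.isMin (suc i))
    ¬max⇒min′ ¬max with k , i<k , Pik ← N.nonMax-witness i<n ¬max =
      from N′.isMin⇔ λ j<1+i P′ →
        <⇒≱ i<k (≤-pred (proj₂ (proj₂ (region P′) (<⇒≤ j<1+i) Pik (≤-pred j<1+i) ≤-refl)))

  module LastBlock {b : ℕ} (min-b : T (N.isMin b)) (Pbm : T (P b m)) where
    b<n : b < suc m
    b<n = proj₁ (bounded Pbm)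

    notMax′≡isMin : ∀ {i} → i < suc m → i ≢ b → N′.notMax i ≡ N.isMin i
    notMax′≡isMin {i} i<n i≢b = trans (cong not (≡not-intro min⇒¬max′ ¬min⇒max′)) (not-involutive (N.isMin i))
      where
      min⇒¬max′ : T (N.isMin i) → ¬ T (N′.isMax i)
      min⇒¬max′ min-i max′ with M , i≤M , PiM , max-M ← N.blockMax i<n
                           with m≤n⇒m<n∨m≡n (≤-pred (proj₂ (bounded PiM)))
      ... | inj₂ refl = i≢b (N.min-unique (transitive PiM (symmetric Pbm)) min-i min-b)
      ... | inj₁ M<m =
        to N′.isMax⇔ max′ (s≤s i≤M)
          (P′-intro i<n (s≤s M<m) (SameRegion-intro (m≤n⇒m≤1+n i≤M) (N.block-closed PiM min-i max-M)))
      ¬min⇒max′ : ¬ T (N.isMin i) → T (N′.isMax i)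
      ¬min⇒max′ ¬min with l , l<i , Pil ← N.nonMin-witness i<n ¬min =
        from N′.isMax⇔ λ i<j P′ → <⇒≱ l<i (proj₁ (proj₁ (region P′) (<⇒≤ i<j) Pil ≤-refl i<j))

    isMax′-b : T (N′.isMax b)
    isMax′-b = from N′.isMax⇔ λ b<j P′ →
      <⇒≱ (proj₂ (proj₁ (region P′) (<⇒≤ b<j) Pbm ≤-refl b<j)) (≤-pred (proj₁ (proj₂ (to P′⇔ P′))))

    letters′≡interleave : ∀ xs → All (λ x → x < suc m × x ≢ b) xs →
      N′.letters xs ≡ interleave (before N.notMax) N.isMin xs
    letters′≡interleave [] [] = refl
    letters′≡interleave (x ∷ xs) ((x<n , x≢b) ∷ rest) =
      cong₂ _∷_ (isMin′≡before x<n) (cong₂ _∷_ (notMax′≡isMin x<n x≢b) (letters′≡interleave xs rest))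

    A B : Word
    A = N.letters (range 0 b)
    B = interleave (before N.notMax) N.isMin (range (suc b) (suc m))

    around-b : range 0 (suc m) ≡ range 0 b ++ b ∷ range (suc b) (suc m)
    around-b = trans (range-split z≤n (<⇒≤ b<n)) (cong (range 0 b ++_) (range-head b<n))

    word-split : N.letters (range 0 (suc m)) ≡ A ++ U ∷ B ++ R ∷ []
    word-split = begin
      N.letters (range 0 (suc m))
        ≡⟨ trans (cong N.letters around-b) (interleave-++ _ _ (range 0 b) _) ⟩
      A ++ N.isMin b ∷ N.notMax b ∷ N.letters (range (suc b) (suc m))
        ≡⟨ cong₂ (λ u w → A ++ u ∷ w) (to T-≡ min-b) (interleave-shift-range N.isMin N.notMax b<n) ⟩
      A ++ U ∷ B ++ N.notMax m ∷ []
        ≡⟨ cong (λ u → A ++ U ∷ B ++ not u ∷ []) (to T-≡ max-last) ⟩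
      A ++ U ∷ B ++ R ∷ [] ∎
      where open ≡-Reasoning

    word′-split : N′.letters (range 0 (suc m)) ≡ U ∷ A ++ R ∷ B
    word′-split = begin
      N′.letters (range 0 (suc m))
        ≡⟨ trans (cong N′.letters around-b) (interleave-++ _ _ (range 0 b) _) ⟩
      N′.letters (range 0 b) ++ N′.isMin b ∷ N′.notMax b ∷ N′.letters (range (suc b) (suc m))
        ≡⟨ cong₂ (λ u w → u ++ w)
             (letters′≡interleave (range 0 b) (All-range 0 b (λ _ j<b → <-trans j<b b<n , <⇒≢ j<b)))
             (cong₂ _∷_ (isMin′≡before b<n) (cong₂ _∷_ (cong not (to T-≡ isMax′-b))
               (letters′≡interleave (range (suc b) (suc m)) (All-range (suc b) (suc m) (λ b<j j<n → j<n , >⇒≢ b<j))))) ⟩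
      interleave (before N.notMax) N.isMin (range 0 b) ++ before N.notMax b ∷ R ∷ B
        ≡⟨ sym (++-assoc (interleave (before N.notMax) N.isMin (range 0 b)) _ _) ⟩
      (interleave (before N.notMax) N.isMin (range 0 b) ++ before N.notMax b ∷ []) ++ R ∷ B
        ≡⟨ cong (_++ R ∷ B) (sym (interleave-shift-range N.isMin N.notMax z≤n)) ⟩
      U ∷ A ++ R ∷ B ∎
      where open ≡-Reasoning

    dyck-A : Dyck A
    dyck-A = N.dyck-prefix (<⇒≤ b<n) (closed-∖ʳ (<⇒≤ b<n) N.closed-all (N.block-closed Pbm min-b max-last))

    dyck-B : Dyck B
    dyck-B = dyck-suffix dyck-A (subst Dyck word′-split (N′.dyck-prefix ≤-refl N′.closed-all))

    rotation-letters : ∀ x y → Paired (σ (suc m) (toMatching (N.letters (range 0 (suc m))))) x y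
                             ⇔ Paired (toMatching (N′.letters (range 0 (suc m)))) x y
    rotation-letters x y =
      subst₂ (λ w w′ → Paired (σ (suc m) (toMatching w)) x y ⇔ Paired (toMatching w′) x y)
        (sym word-split) (sym word′-split) (rotation (suc m) dyck-A dyck-B length-word x y)
      where
      length-word : length (A ++ U ∷ B ++ R ∷ []) ≡ 2 * suc m
      length-word = trans (cong length (sym word-split))
        (trans (length-interleave _ _ (range 0 (suc m))) (cong (2 *_) (length-ints 0 (suc m))))

  rotation-letters : ∀ x y → Paired (σ (suc m) (toMatching (N.letters (range 0 (suc m))))) x y
                           ⇔ Paired (toMatching (N′.letters (range 0 (suc m)))) x y
  rotation-letters with b , _ , Pmb , min-b ← N.blockMin (n<1+n m) = LastBlock.rotation-letters min-b (symmetric Pmb)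

-- Partitions of Fin n as relations on ℕ

module _ {n : ℕ} where

  lift : BlockRel n → ℕ → ℕ → Bool
  lift π i j with i <? n | j <? n
  ... | yes i<n | yes j<n = π (fromℕ< i<n) (fromℕ< j<n)
  ... | _ | _ = false

  lift-bounded : ∀ π {i j} → T (lift π i j) → i < n × j < n
  lift-bounded π {i} {j} t with i <? n | j <? n
  ... | yes i<n | yes j<n = i<n , j<n

  -- fromℕ< ignores its (irrelevant) proof argument, so lift⁻ and lift⁺ hold for any bound proofs.
  lift⁻ : ∀ π {i j} → T (lift π i j) → (i<n : i < n) (j<n : j < n) → T (π (fromℕ< i<n) (fromℕ< j<n))
  lift⁻ π {i} {j} t _ _ with i <? n | j <? n
  ... | yes _ | yes _ = t

  lift⁺ : ∀ π {i j} (i<n : i < n) (j<n : j < n) → T (π (fromℕ< i<n) (fromℕ< j<n)) → T (lift π i j)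
  lift⁺ π {i} {j} i<n j<n t with i <? n | j <? n
  ... | yes _ | yes _ = t
  ... | no i≮n | _ = i≮n i<n
  ... | yes _ | no j≮n = j≮n j<n

  lift-toℕ : ∀ π (a b : Fin n) → lift π (toℕ a) (toℕ b) ≡ π a b
  lift-toℕ π a b with toℕ a <? n | toℕ b <? n
  ... | yes _ | yes _ = cong₂ π (fromℕ<-toℕ a _) (fromℕ<-toℕ b _)
  ... | no a≮n | _ = ⊥-elim (a≮n (toℕ<n a))
  ... | yes _ | no b≮n = ⊥-elim (b≮n (toℕ<n b))

  fromℕ<-mono : ∀ {i j} (i<n : i < n) (j<n : j < n) → i < j → fromℕ< i<n Fin.< fromℕ< j<n
  fromℕ<-mono i<n j<n = subst₂ _<_ (sym (toℕ-fromℕ< i<n)) (sym (toℕ-fromℕ< j<n))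

  lift-isNC : ∀ {π} → IsNC π → IsNCPartition n (lift π)
  lift-isNC {π} (isPartition , nonCrossing) = record
    { bounded     = lift-bounded π
    ; reflexive   = λ i<n → lift⁺ π i<n i<n (reflexive _)
    ; symmetric   = λ t → let i<n , j<n = lift-bounded π t in lift⁺ π j<n i<n (symmetric _ _ (lift⁻ π t i<n j<n))
    ; transitive  = λ t u → let i<n , j<n = lift-bounded π t ; _ , k<n = lift-bounded π u in
                      lift⁺ π i<n k<n (transitive _ _ _ (lift⁻ π t i<n j<n) (lift⁻ π u j<n k<n))
    ; noncrossing = λ i<j j<k k<l t u → let i<n , k<n = lift-bounded π t ; j<n , l<n = lift-bounded π u in
                      lift⁺ π i<n j<n (nonCrossing _ _ _ _ (fromℕ<-mono i<n j<n i<j) (fromℕ<-mono j<n k<n j<k)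
                        (fromℕ<-mono k<n l<n k<l) (lift⁻ π t i<n k<n) (lift⁻ π u j<n l<n))
    }
    where open IsSetPartition isPartition

  lift-intro : ∀ π {a b : Fin n} → T (π a b) → T (lift π (toℕ a) (toℕ b))
  lift-intro π {a} {b} = subst T (sym (lift-toℕ π a b))

  data Lifted (π : BlockRel n) : ℕ → ℕ → Set where
    lifted : ∀ a b → T (π a b) → Lifted π (toℕ a) (toℕ b)

  lift-view : ∀ π {i j} → T (lift π i j) → Lifted π i j
  lift-view π t with i<n , j<n ← lift-bounded π t =
    subst₂ (Lifted π) (toℕ-fromℕ< i<n) (toℕ-fromℕ< j<n) (lifted _ _ (lift⁻ π t i<n j<n))

  T-inArc : ∀ (a b k : Fin n) → T (inArc a b k) ⇔ (toℕ a ≤ toℕ k × toℕ k < toℕ b)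
  T-inArc a b k = mk⇔
    (λ t → let a≤k , k<b = to T-∧ t in to (T-does (a Fin.≤? k)) a≤k , to (T-does (k Fin.<? b)) k<b)
    (λ (a≤k , k<b) → from T-∧ (from (T-does (a Fin.≤? k)) a≤k , from (T-does (k Fin.<? b)) k<b))

  T-sameRegion : ∀ π (a b : Fin n) → T (sameRegion π a b) ⇔ Closed (lift π) (toℕ a) (toℕ b)
  T-sameRegion π a b = mk⇔ stays⇒closed closed⇒stays
    where
    stays⇔ : ∀ x y z → T (not (x ∧ not y ∧ z)) ⇔ (T x → T z → T y)
    stays⇔ false y z = mk⇔ (λ _ ()) (λ _ → tt)
    stays⇔ true true z = mk⇔ (λ _ _ _ → tt) (λ _ → tt)
    stays⇔ true false false = mk⇔ (λ _ _ ()) (λ _ → tt)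
    stays⇔ true false true = mk⇔ (λ ()) (λ h → h tt tt)

    stays⇒closed : T (sameRegion π a b) → Closed (lift π) (toℕ a) (toℕ b)
    stays⇒closed t Pkl a≤k k<b with lift-view π Pkl
    ... | lifted k l p = to (T-inArc a b l) (to (stays⇔ _ _ _) stays (from (T-inArc a b k) (a≤k , k<b)) p)
      where
      stays : T (not (inArc a b k ∧ not (inArc a b l) ∧ π k l))
      stays = to (T-allB _ (allFin n)) (to (T-allB _ (allFin n)) t (∈-allFin k)) (∈-allFin l)

    closed⇒stays : Closed (lift π) (toℕ a) (toℕ b) → T (sameRegion π a b)
    closed⇒stays closed = from (T-allB _ (allFin n)) λ {k} _ → from (T-allB _ (allFin n)) λ {l} _ →
      from (stays⇔ _ _ _) λ k-in p → let a≤k , k<b = to (T-inArc a b k) k-in in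
        from (T-inArc a b l) (closed (lift-intro π p) a≤k k<b)

  T-ρ : ∀ π (a b : Fin n) → T (ρ π a b) ⇔ SameRegion (lift π) (toℕ a) (toℕ b)
  -- ρ is stuck on toℕ a ≤ᵇ toℕ b, the computed form of does (a ≤? b).
  T-ρ π a b with toℕ a ≤ᵇ toℕ b | T-does (a Fin.≤? b)
  ... | true | a≤?b =
    mk⇔ (SameRegion-intro a≤b ∘ to (T-sameRegion π a b)) (from (T-sameRegion π a b) ∘ (λ r → proj₁ r a≤b))
    where
    a≤b : toℕ a ≤ toℕ b
    a≤b = to a≤?b tt
  ... | false | a≤?b =
    mk⇔ (swap ∘ SameRegion-intro b≤a ∘ to (T-sameRegion π b a)) (from (T-sameRegion π b a) ∘ (λ r → proj₂ r b≤a))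
    where
    b≤a : toℕ b ≤ toℕ a
    b≤a = <⇒≤ (≰⇒> (from a≤?b))

  lift-ρ⇔ : ∀ π {i j} → T (lift (ρ π) i j) ⇔ (i < n × j < n × SameRegion (lift π) i j)
  lift-ρ⇔ π {i} {j} = mk⇔ to′ from′
    where
    to′ : T (lift (ρ π) i j) → i < n × j < n × SameRegion (lift π) i j
    to′ t with lift-view (ρ π) t
    ... | lifted a b p = toℕ<n a , toℕ<n b , to (T-ρ π a b) p
    from′ : i < n × j < n × SameRegion (lift π) i j → T (lift (ρ π) i j)
    from′ (i<n , j<n , r) = lift⁺ (ρ π) i<n j<n
      (from (T-ρ π _ _) (subst₂ (SameRegion (lift π)) (sym (toℕ-fromℕ< i<n)) (sym (toℕ-fromℕ< j<n)) r))

map-filter : ∀ {A : Set} {f : A → Bool} (d : ∀ x → Dec (T (f x))) (h : A → ℕ) {g : ℕ → Bool} →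
  (∀ x → f x ≡ g (h x)) → ∀ xs → map h (filter d xs) ≡ filter (T? ∘ g) (map h xs)
map-filter d h eq [] = refl
map-filter d h {g} eq (x ∷ xs) with d x
... | yes fx = trans (cong (h x ∷_) (map-filter d h eq xs)) (sym (filter-accept (T? ∘ g) (subst T (eq x) fx)))
... | no ¬fx = trans (map-filter d h eq xs) (sym (filter-reject (T? ∘ g) (¬fx ∘ subst T (sym (eq x)))))

map-suc-ints : ∀ a k → map suc (ints a k) ≡ ints (suc a) k
map-suc-ints a zero = refl
map-suc-ints a (suc k) = cong (suc a ∷_) (map-suc-ints (suc a) k)

allFin-toℕ : ∀ n → map toℕ (allFin n) ≡ range 0 n
allFin-toℕ n = trans (map-tabulate (λ i → i) toℕ) (tabulate-toℕ n)
  where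
  tabulate-toℕ : ∀ n → tabulate {n = n} toℕ ≡ ints 0 n
  tabulate-toℕ zero = refl
  tabulate-toℕ (suc n) =
    cong (0 ∷_) (trans (sym (map-tabulate toℕ suc)) (trans (cong (map suc) (tabulate-toℕ n)) (map-suc-ints 0 n)))

module _ {n : ℕ} {π : BlockRel n} (isNC : IsNCPartition n (lift π)) where
  open Blocks isNC

  isMin-toℕ⇔ : ∀ m → T (isMin (toℕ m)) ⇔ (∀ j → toℕ j < toℕ m → ¬ T (π m j))
  isMin-toℕ⇔ m = mk⇔
    (λ min-m j j<m p → to isMin⇔ min-m j<m (lift-intro π p))
    (λ h → from isMin⇔ λ {j} j<m Pmj → let j<n = <-trans j<m (toℕ<n m) in
      h (fromℕ< j<n) (subst (_< toℕ m) (sym (toℕ-fromℕ< j<n)) j<m)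
        (subst T (trans (cong (lift π (toℕ m)) (sym (toℕ-fromℕ< j<n))) (lift-toℕ π m _)) Pmj))

  isBlockMin⇔ : ∀ m → T (isBlockMin π m) ⇔ (∀ j → toℕ j < toℕ m → ¬ T (π m j))
  isBlockMin⇔ m = mk⇔
    (λ t j j<m p → to T-not (to (T-allB _ (allFin n)) t (∈-allFin j)) (from T-∧ (from (T-does (j Fin.<? m)) j<m , p)))
    (λ h → from (T-allB _ (allFin n)) λ {j} _ → from T-not λ q →
      let j<m , p = to T-∧ q in h j (to (T-does (j Fin.<? m)) j<m) p)

  isBlockMin≡isMin : ∀ m → isBlockMin π m ≡ isMin (toℕ m)
  isBlockMin≡isMin m =
    T-injective (mk⇔ (from (isMin-toℕ⇔ m) ∘ to (isBlockMin⇔ m)) (from (isBlockMin⇔ m) ∘ to (isMin-toℕ⇔ m)))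

  blockMins-toℕ : map toℕ (blockMins π) ≡ minima n
  blockMins-toℕ =
    trans (map-filter _ toℕ isBlockMin≡isMin (allFin n)) (cong (filter (T? ∘ isMin)) (allFin-toℕ n))

  blockSize-toℕ : ∀ m → blockSize π m ≡ blockCard (toℕ m)
  blockSize-toℕ m = begin
    length (filter _ (allFin n))
      ≡⟨ sym (length-map toℕ (filter _ (allFin n))) ⟩
    length (map toℕ (filter _ (allFin n)))
      ≡⟨ cong length (map-filter _ toℕ (λ j → sym (lift-toℕ π m j)) (allFin n)) ⟩
    length (filter (T? ∘ lift π (toℕ m)) (map toℕ (allFin n)))
      ≡⟨ cong (length ∘ filter (T? ∘ lift π (toℕ m))) (allFin-toℕ n) ⟩
    blockCard (toℕ m) ∎
    where open ≡-Reasoning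

  κ≡letters : κ π ≡ letters (range 0 n)
  κ≡letters = begin
    κ π
      ≡⟨ foldl-cong (λ w m → cong (λ s → insertAfter (2 * toℕ m) (D s) w) (blockSize-toℕ m)) [] (blockMins π) ⟩
    foldl (λ w m → step w (toℕ m)) [] (blockMins π)
      ≡⟨ sym (foldl-map step toℕ [] (blockMins π)) ⟩
    foldl step [] (map toℕ (blockMins π))
      ≡⟨ cong (foldl step []) blockMins-toℕ ⟩
    foldl step [] (minima n)
      ≡⟨ insertions≡letters ⟩
    letters (range 0 n) ∎
    where open ≡-Reasoning

mainTheorem8 : (n : ℕ) → 1 ≤ n → (π : BlockRel n) → IsNC π →
    ∀ (x y : ℕ) →
      Paired (σ n (toMatching (κ π))) x y ⇔ Paired (toMatching (κ (ρ π))) x y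
mainTheorem8 (suc m) _ π isnc x y =
  subst₂ (λ w w′ → Paired (σ (suc m) (toMatching w)) x y ⇔ Paired (toMatching w′) x y)
    (sym (κ≡letters isNC)) (sym (κ≡letters K.isNC′)) (K.rotation-letters x y)
  where
  isNC : IsNCPartition (suc m) (lift π)
  isNC = lift-isNC isnc
  module K = Kreweras isNC (lift-ρ⇔ π)
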